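{- Let $n,k$ be positive integers with $n\ge 5$, $k<n/2$, $n = 7k/i$ for some $i \in \{1,2,3\}$, and either $n \ge 42$ or $(n,k) \in \{(28,8),(35,10),(35,15)\}$. Consider the game of cops and robbers on $GP(n,k)$ with three cops. Let $r$ be the robber's vertex, with neighbours $v_1,v_2,v_3$. Suppose that for every $i\in\{1,2,3\}$, either some cop lies on a branch of $v_i$ at distance at most $2$ from $r$, or each of the two branches of $v_i$ contains at least one cop, and that the first alternative holds for at least one $i$. Then the robber is trapped.
   Context: The generalised Petersen graph $GP(n,k)$ has vertex set $\{a_0,\dots,a_{n-1}\}\cup\{b_0,\dots,b_{n-1}\}$ and edges $\{a_j,a_{j+1}\}$, $\{a_j,b_j\}$, $\{b_j,b_{j+k}\}$ (subscripts mod $n$). In cops and robbers, the cop player first places the cops, then the robber is placed; afterwards players alternate (cops first), each moving any or all of their pieces to adjacent vertices or staying; a cop captures the robber by occupying the robber's vertex. Branches: for the robber's vertex $r$ and a neighbour $v_i$ of $r$, let $u$ be one of the two neighbours of $v_i$ other than $r$; the branch of $v_i$ through $u$ consists of the $8$ vertices $v_i$, $u$, the two neighbours of $u$ other than $v_i$, and the four further vertices adjacent to those two (other than $u$), i.e. all vertices on paths of length up to $4$ from $r$ that start $r,v_i,u$. Each $v_i$ has two branches. Trapped: the cops have trapped the robber if each of the three neighbours $v_1,v_2,v_3$ of the robber's vertex has a cop on it or on a vertex adjacent to it (regardless of whose turn it is), or if it is the cops' turn and some cop is adjacent to the robber. -}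

module Defs where

open import Data.Nat using (ℕ; zero; suc; _+_; NonZero)
open import Data.Nat.DivMod using (_%_)
open import Data.Fin using (Fin; toℕ)
open import Data.Product using (Σ; ∃; _×_; _,_)
open import Data.Sum using (_⊎_)
open import Relation.Binary.PropositionalEquality using (_≡_; _≢_)

data Vertex (n : ℕ) : Set where
  a : Fin n → Vertex n
  b : Fin n → Vertex n

Adj : (n k : ℕ) → .{{_ : NonZero n}} → Vertex n → Vertex n → Set
Adj n k (a i) (a j) = (toℕ j ≡ (toℕ i + 1) % n) ⊎ (toℕ i ≡ (toℕ j + 1) % n)
Adj n k (a i) (b j) = i ≡ j
Adj n k (b i) (a j) = i ≡ j
Adj n k (b i) (b j) = (toℕ j ≡ (toℕ i + k) % n) ⊎ (toℕ i ≡ (toℕ j + k) % n)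

DistLe : (n k : ℕ) → .{{_ : NonZero n}} → ℕ → Vertex n → Vertex n → Set
DistLe n k zero x y = x ≡ y
DistLe n k (suc m) x y = (x ≡ y) ⊎ (∃ λ w → Adj n k x w × DistLe n k m w y)

-- The branch of v through u (u a neighbour of v other than the robber vertex):
-- the vertices v, u, the neighbours w of u other than v, and the neighbours of
-- such w other than u.
InBranch : (n k : ℕ) → .{{_ : NonZero n}} → (v u x : Vertex n) → Set
InBranch n k v u x =
  (x ≡ v) ⊎ (x ≡ u) ⊎
  (∃ λ w → Adj n k u w × w ≢ v × ((x ≡ w) ⊎ (Adj n k w x × x ≢ u)))

Cops : ℕ → Set
Cops n = Fin 3 → Vertex n

CloseCop : (n k : ℕ) → .{{_ : NonZero n}} → Cops n → (r v : Vertex n) → Set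
CloseCop n k c r v =
  ∃ λ u → Adj n k v u × u ≢ r ×
    (∃ λ i → InBranch n k v u (c i) × DistLe n k 2 (c i) r)

BothBranches : (n k : ℕ) → .{{_ : NonZero n}} → Cops n → (r v : Vertex n) → Set
BothBranches n k c r v =
  ∀ u → Adj n k v u → u ≢ r → ∃ λ i → InBranch n k v u (c i)

data Turn : Set where
  copsTurn robberTurn : Turn

Trapped : (n k : ℕ) → .{{_ : NonZero n}} → Cops n → Vertex n → Turn → Set
Trapped n k c r t =
  (∀ v → Adj n k r v → ∃ λ i → (c i ≡ v) ⊎ Adj n k (c i) v)
  ⊎ ((t ≡ copsTurn) × (∃ λ i → Adj n k (c i) r))

module Submission where

-- Suppose a neighbour v of the robber were uncovered.  A cop close to r on a branch of v sits on v
-- or on the second vertex of that branch, and so covers v; hence both branches of v hold a cop,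
-- necessarily in their deep parts (the vertices at distance 3 and 4 from r), and these are two
-- different cops.  The cop close to some other neighbour w is a third one.  The remaining
-- neighbour u then needs a cop close to r or a cop on a branch of u that avoids both deep cops,
-- and such a cop is none of the three.  Every separation used here concerns vertices within
-- distance 4 of r; writing them in local coordinates j + x + y k, each is a non-congruence
-- x + y k ≢ 0 (mod n) for small symbolic x, y, which is checked by computation: directly for the
-- finitely many small (n, k), and uniformly for n = 7m, k = im with m ≥ 9.

open import Defs
open import Data.Bool using (Bool; true; T; not)
open import Data.Bool.ListAction using (all; any)
open import Data.Empty using (⊥; ⊥-elim)
open import Data.Fin using (Fin; toℕ; fromℕ<)
open import Data.Fin.Properties using (toℕ-injective; toℕ-fromℕ<; toℕ<n; all?; _≟_)
open import Data.Integer as ℤ using (ℤ; +_; -[1+_]; _+_; _-_; -_; 0ℤ; 1ℤ; ∣_∣)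
import Data.Integer.Properties as ℤ
open import Data.Integer.DivMod using (_%ℕ_; _/ℕ_; n%ℕd<d; a≡a%ℕn+[a/ℕn]*n)
open import Data.Integer.Divisibility.Signed
  using (_∣_; divides; ∣⇒∣ᵤ; ∣-trans; ∣m∣n⇒∣m+n; ∣m⇒∣-m; ∣n⇒∣m*n; ∣m+n∣n⇒∣m)
import Data.Integer.Tactic.RingSolver as ℤ-Ring
open import Data.List using (List; []; _∷_; map; concatMap)
open import Data.List.Membership.Propositional using (_∈_; find; lose)
open import Data.List.Relation.Unary.All as All using (lookupAny)
open import Data.List.Relation.Unary.All.Properties using (all⁺)
open import Data.List.Relation.Unary.Any as Any using (Any; here; there)
open import Data.List.Relation.Unary.Any.Properties using (any⁻; map⁺; concatMap⁺)
open import Data.Nat as ℕ using (ℕ; zero; suc; NonZero; _*_; _≤_; _<_; s≤s; _≡ᵇ_; _≤ᵇ_)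
import Data.Nat.Properties as ℕ
open import Data.Nat.DivMod using (_%_; m<n⇒m%n≡m)
import Data.Nat.Divisibility as ℕ∣
open import Data.Nat.Primality using (Prime; prime?; euclidsLemma)
import Data.Nat.Tactic.RingSolver as ℕ-Ring
open import Data.Product using (Σ; ∃; _×_; _,_)
open import Data.Sum using (_⊎_; inj₁; inj₂; [_,_])
open import Function using (_∘_; id)
open import Relation.Binary.PropositionalEquality
  using (_≡_; _≢_; refl; sym; trans; cong; subst; module ≡-Reasoning)
open import Relation.Nullary using (¬_; contradiction)
open import Relation.Nullary.Decidable using (_⊎-dec_; toWitness; from-yes)

i+j-j≡i : ∀ i j → i + j - j ≡ i
i+j-j≡i = ℤ-Ring.solve-∀

i-j+j≡i : ∀ i j → i - j + j ≡ i
i-j+j≡i = ℤ-Ring.solve-∀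

infix 4 _≡_mod_
record _≡_mod_ (x y : ℤ) (n : ℕ) : Set where
  constructor congruent
  field n∣x-y : + n ∣ x - y

module _ {n : ℕ} where

  mod-sym : ∀ {x y} → x ≡ y mod n → y ≡ x mod n
  mod-sym {x} {y} (congruent n∣x-y) = congruent (subst (+ n ∣_) (negate-difference x y) (∣m⇒∣-m n∣x-y))
    where negate-difference : ∀ x y → - (x - y) ≡ y - x
          negate-difference = ℤ-Ring.solve-∀

  mod-trans : ∀ {x y z} → x ≡ y mod n → y ≡ z mod n → x ≡ z mod n
  mod-trans {x} {y} {z} (congruent n∣x-y) (congruent n∣y-z) =
    congruent (subst (+ n ∣_) (ℤ.+-minus-telescope x y z) (∣m∣n⇒∣m+n n∣x-y n∣y-z))

  mod-+ʳ : ∀ {x y} d → x ≡ y mod n → x + d ≡ y + d mod n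
  mod-+ʳ {x} {y} d (congruent n∣x-y) = congruent (subst (+ n ∣_) (shift-difference x y d) n∣x-y)
    where shift-difference : ∀ x y d → x - y ≡ (x + d) - (y + d)
          shift-difference = ℤ-Ring.solve-∀

module _ (n : ℕ) .{{_ : NonZero n}} where

  mod-residue : ∀ z → z ≡ + (z %ℕ n) mod n
  mod-residue z = congruent (divides (z /ℕ n) (begin
    z - + r                 ≡⟨ cong (_- + r) (a≡a%ℕn+[a/ℕn]*n z n) ⟩
    + r + q ℤ.* + n - + r   ≡⟨ cong (_- + r) (ℤ.+-comm (+ r) (q ℤ.* + n)) ⟩
    q ℤ.* + n + + r - + r   ≡⟨ i+j-j≡i (q ℤ.* + n) (+ r) ⟩
    q ℤ.* + n               ∎))
    where open ≡-Reasoning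
          r = z %ℕ n
          q = z /ℕ n

  residue-unique : ∀ {x y} → x < n → y < n → + x ≡ + y mod n → x ≡ y
  residue-unique {x} {y} x<n y<n (congruent n∣x-y) =
    ℤ.+-injective (ℤ.i-j≡0⇒i≡j _ _ (ℤ.∣i∣≡0⇒i≡0 difference-zero))
    where
      difference-small : ∣ + x - + y ∣ < n
      difference-small = ℕ.≤-<-trans (ℕ.≤-reflexive (cong ∣_∣ (ℤ.m-n≡m⊖n x y)))
                           (ℕ.≤-<-trans (ℤ.∣m⊝n∣≤m⊔n x y) (ℕ.⊔-pres-<m x<n y<n))
      difference-zero : ∣ + x - + y ∣ ≡ 0
      difference-zero with ∣ + x - + y ∣ | ∣⇒∣ᵤ n∣x-y | difference-small
      ... | zero  | _   | _   = refl
      ... | suc _ | n∣d | d<n = contradiction (ℕ∣.∣⇒≤ n∣d) (ℕ.<⇒≱ d<n)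

  fromℤ : ℤ → Fin n
  fromℤ z = fromℕ< (n%ℕd<d z n)

  toℕ-fromℤ : ∀ z → toℕ (fromℤ z) ≡ z %ℕ n
  toℕ-fromℤ z = toℕ-fromℕ< (n%ℕd<d z n)

  mod-fromℤ : ∀ z → z ≡ + toℕ (fromℤ z) mod n
  mod-fromℤ z = subst (λ r → z ≡ + r mod n) (sym (toℕ-fromℤ z)) (mod-residue z)

  fromℤ-cong : ∀ {x y} → x ≡ y mod n → fromℤ x ≡ fromℤ y
  fromℤ-cong {x} {y} x≡y = toℕ-injective (residue-unique (toℕ<n (fromℤ x)) (toℕ<n (fromℤ y))
    (mod-trans (mod-sym (mod-fromℤ x)) (mod-trans x≡y (mod-fromℤ y))))

  fromℤ-mod : ∀ {x y} → fromℤ x ≡ fromℤ y → x ≡ y mod n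
  fromℤ-mod {x} {y} eq =
    mod-trans (mod-fromℤ x) (subst (λ i → + toℕ i ≡ y mod n) (sym eq) (mod-sym (mod-fromℤ y)))

  fromℤ-toℕ : ∀ i → fromℤ (+ toℕ i) ≡ i
  fromℤ-toℕ i = toℕ-injective (trans (toℕ-fromℤ (+ toℕ i)) (m<n⇒m%n≡m (toℕ<n i)))

  toℕ-fromℤ-plus : ∀ z d → toℕ (fromℤ (z + + d)) ≡ (toℕ (fromℤ z) ℕ.+ d) % n
  toℕ-fromℤ-plus z d = begin
    toℕ (fromℤ (z + + d))        ≡⟨ cong toℕ (fromℤ-cong (mod-+ʳ (+ d) (mod-fromℤ z))) ⟩
    toℕ (fromℤ (+ r + + d))      ≡⟨ cong (toℕ ∘ fromℤ) (ℤ.pos-+ r d) ⟨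
    toℕ (fromℤ (+ (r ℕ.+ d)))    ≡⟨ toℕ-fromℤ (+ (r ℕ.+ d)) ⟩
    (r ℕ.+ d) % n                ∎
    where open ≡-Reasoning
          r = toℕ (fromℤ z)

  fromℤ-plus-unique : ∀ z d {i} → toℕ i ≡ (toℕ (fromℤ z) ℕ.+ d) % n → i ≡ fromℤ (z + + d)
  fromℤ-plus-unique z d eq = toℕ-injective (trans eq (sym (toℕ-fromℤ-plus z d)))

  fromℤ-minus-unique : ∀ z d {i} → toℕ (fromℤ z) ≡ (toℕ i ℕ.+ d) % n → i ≡ fromℤ (z - + d)
  fromℤ-minus-unique z d {i} eq = begin
    i                              ≡⟨ fromℤ-toℕ i ⟨
    fromℤ (+ toℕ i)                ≡⟨ cong fromℤ (i+j-j≡i (+ toℕ i) (+ d)) ⟨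
    fromℤ (+ toℕ i + + d - + d)    ≡⟨ fromℤ-cong (mod-+ʳ (- + d) i+d≡z) ⟩
    fromℤ (z - + d)                ∎
    where
      open ≡-Reasoning
      i+d≡z : + toℕ i + + d ≡ z mod n
      i+d≡z = fromℤ-mod (sym (fromℤ-plus-unique (+ toℕ i) d
                (trans eq (cong (λ r → (toℕ r ℕ.+ d) % n) (sym (fromℤ-toℕ i))))))

data Side : Set where
  outer inner : Side

data Move : Set where
  fwd bwd spoke : Move

back : Move → Move
back fwd   = bwd
back bwd   = fwd
back spoke = spoke

other₁ other₂ : Move → Move
other₁ fwd   = bwd
other₁ bwd   = fwd
other₁ spoke = fwd
other₂ fwd   = spoke
other₂ bwd   = spoke
other₂ spoke = bwd

others : Move → List Move
others m = other₁ m ∷ other₂ m ∷ []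

forward : Move → List Move
forward m = others (back m)

moves : List Move
moves = fwd ∷ bwd ∷ spoke ∷ []

∈-moves : ∀ m → m ∈ moves
∈-moves fwd   = here refl
∈-moves bwd   = there (here refl)
∈-moves spoke = there (there (here refl))

≡⊎∈others : ∀ m m′ → m ≡ m′ ⊎ m′ ∈ others m
≡⊎∈others fwd   fwd   = inj₁ refl
≡⊎∈others fwd   bwd   = inj₂ (here refl)
≡⊎∈others fwd   spoke = inj₂ (there (here refl))
≡⊎∈others bwd   fwd   = inj₂ (here refl)
≡⊎∈others bwd   bwd   = inj₁ refl
≡⊎∈others bwd   spoke = inj₂ (there (here refl))
≡⊎∈others spoke fwd   = inj₂ (here refl)
≡⊎∈others spoke bwd   = inj₂ (there (here refl))
≡⊎∈others spoke spoke = inj₁ refl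

third : ∀ m {m′} → m′ ∈ others m → ∃ λ m″ → m″ ∈ others m × m′ ∈ others m″
third fwd   (here refl)         = spoke , there (here refl) , there (here refl)
third fwd   (there (here refl)) = bwd   , here refl         , there (here refl)
third bwd   (here refl)         = spoke , there (here refl) , here refl
third bwd   (there (here refl)) = fwd   , here refl         , there (here refl)
third spoke (here refl)         = bwd   , there (here refl) , here refl
third spoke (there (here refl)) = fwd   , here refl         , here refl

-- pos s x y stands for the vertex on side s with index j + x + y k, for a base index j fixed later;
-- keeping x and y symbolic lets one computation serve all n, k and j.
record Pos : Set where
  constructor pos
  field
    side : Side
    x y  : ℤ

move : Pos → Move → Pos
move (pos outer x y) fwd   = pos outer (x + 1ℤ) y
move (pos outer x y) bwd   = pos outer (x - 1ℤ) y
move (pos inner x y) fwd   = pos inner x (y + 1ℤ)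
move (pos inner x y) bwd   = pos inner x (y - 1ℤ)
move (pos outer x y) spoke = pos inner x y
move (pos inner x y) spoke = pos outer x y

origin : Side → Pos
origin s = pos s 0ℤ 0ℤ

neighbour : Side → Move → Pos
neighbour s α = move (origin s) α

nbhd : Pos → List Pos
nbhd p = p ∷ map (move p) moves

fan : (Move → List Move) → Pos → Move → List Pos
fan next p m = move p m ∷ map (move (move p m)) (next m)

ball₂ : Pos → List Pos
ball₂ p = p ∷ concatMap (fan (λ _ → moves) p) moves

beyond : Pos → Move → List Pos
beyond u μ = concatMap (fan forward u) (forward μ)

branch : Pos → Move → List Pos
branch v μ = v ∷ move v μ ∷ beyond (move v μ) μ

deep : Side → Move → Move → List Pos
deep s α μ = beyond (move (neighbour s α) μ) μ

vertexOn : ∀ {n} → Side → Fin n → Vertex n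
vertexOn outer = a
vertexOn inner = b

vertexOn-injective : ∀ {n} s {i i′ : Fin n} → vertexOn s i ≡ vertexOn s i′ → i ≡ i′
vertexOn-injective outer refl = refl
vertexOn-injective inner refl = refl

module Geometry (n k : ℕ) .{{_ : NonZero n}} (j : ℕ) where

  stride : Side → ℕ
  stride outer = 1
  stride inner = k

  index : Pos → ℤ
  index (pos _ x y) = + j + x + y ℤ.* + k

  vertex : Pos → Vertex n
  vertex p = vertexOn (Pos.side p) (fromℤ n (index p))

  vertex-origin : ∀ s → vertex (origin s) ≡ vertexOn s (fromℤ n (+ j))
  vertex-origin s = cong (vertexOn s ∘ fromℤ n) (drop-zeros (+ j) (+ k))
    where drop-zeros : ∀ j k → j + 0ℤ + 0ℤ ℤ.* k ≡ j
          drop-zeros = ℤ-Ring.solve-∀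

  index-fwd : ∀ p → index (move p fwd) ≡ index p + + stride (Pos.side p)
  index-fwd (pos outer x y) = shift (+ j) x y (+ k)
    where shift : ∀ j x y k → j + (x + 1ℤ) + y ℤ.* k ≡ j + x + y ℤ.* k + 1ℤ
          shift = ℤ-Ring.solve-∀
  index-fwd (pos inner x y) = shift (+ j) x y (+ k)
    where shift : ∀ j x y k → j + x + (y + 1ℤ) ℤ.* k ≡ j + x + y ℤ.* k + k
          shift = ℤ-Ring.solve-∀

  index-bwd : ∀ p → index (move p bwd) ≡ index p - + stride (Pos.side p)
  index-bwd (pos outer x y) = shift (+ j) x y (+ k)
    where shift : ∀ j x y k → j + (x - 1ℤ) + y ℤ.* k ≡ j + x + y ℤ.* k - 1ℤ
          shift = ℤ-Ring.solve-∀
  index-bwd (pos inner x y) = shift (+ j) x y (+ k)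
    where shift : ∀ j x y k → j + x + (y - 1ℤ) ℤ.* k ≡ j + x + y ℤ.* k - k
          shift = ℤ-Ring.solve-∀

  rim-fwd : ∀ p → toℕ (fromℤ n (index (move p fwd)))
                  ≡ (toℕ (fromℤ n (index p)) ℕ.+ stride (Pos.side p)) % n
  rim-fwd p = trans (cong (toℕ ∘ fromℤ n) (index-fwd p)) (toℕ-fromℤ-plus n (index p) (stride (Pos.side p)))

  rim-bwd : ∀ p → toℕ (fromℤ n (index p))
                  ≡ (toℕ (fromℤ n (index (move p bwd))) ℕ.+ stride (Pos.side p)) % n
  rim-bwd p = begin
    toℕ (fromℤ n (index p))                     ≡⟨ cong (toℕ ∘ fromℤ n) (i-j+j≡i (index p) (+ d)) ⟨
    toℕ (fromℤ n (index p - + d + + d))         ≡⟨ cong (λ z → toℕ (fromℤ n (z + + d))) (index-bwd p) ⟨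
    toℕ (fromℤ n (index (move p bwd) + + d))    ≡⟨ toℕ-fromℤ-plus n (index (move p bwd)) d ⟩
    (toℕ (fromℤ n (index (move p bwd))) ℕ.+ d) % n ∎
    where
      open ≡-Reasoning
      d = stride (Pos.side p)

  move-adjacent : ∀ p m → Adj n k (vertex p) (vertex (move p m))
  move-adjacent p@(pos outer _ _) fwd   = inj₁ (rim-fwd p)
  move-adjacent p@(pos outer _ _) bwd   = inj₂ (rim-bwd p)
  move-adjacent   (pos outer _ _) spoke = refl
  move-adjacent p@(pos inner _ _) fwd   = inj₁ (rim-fwd p)
  move-adjacent p@(pos inner _ _) bwd   = inj₂ (rim-bwd p)
  move-adjacent   (pos inner _ _) spoke = refl

  fwd-unique : ∀ p {i} → toℕ i ≡ (toℕ (fromℤ n (index p)) ℕ.+ stride (Pos.side p)) % n →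
               i ≡ fromℤ n (index (move p fwd))
  fwd-unique p eq = trans (fromℤ-plus-unique n (index p) _ eq) (cong (fromℤ n) (sym (index-fwd p)))

  bwd-unique : ∀ p {i} → toℕ (fromℤ n (index p)) ≡ (toℕ i ℕ.+ stride (Pos.side p)) % n →
               i ≡ fromℤ n (index (move p bwd))
  bwd-unique p eq = trans (fromℤ-minus-unique n (index p) _ eq) (cong (fromℤ n) (sym (index-bwd p)))

  adjacent-move : ∀ p {v} → Adj n k (vertex p) v → ∃ λ m → v ≡ vertex (move p m)
  adjacent-move p@(pos outer _ _) {a _} (inj₁ e) = fwd   , cong a (fwd-unique p e)
  adjacent-move p@(pos outer _ _) {a _} (inj₂ e) = bwd   , cong a (bwd-unique p e)
  adjacent-move   (pos outer _ _) {b _} refl     = spoke , refl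
  adjacent-move   (pos inner _ _) {a _} refl     = spoke , refl
  adjacent-move p@(pos inner _ _) {b _} (inj₁ e) = fwd   , cong b (fwd-unique p e)
  adjacent-move p@(pos inner _ _) {b _} (inj₂ e) = bwd   , cong b (bwd-unique p e)

  Adj-sym : ∀ {v w} → Adj n k v w → Adj n k w v
  Adj-sym {a _} {a _} (inj₁ e) = inj₂ e
  Adj-sym {a _} {a _} (inj₂ e) = inj₁ e
  Adj-sym {a _} {b _} e        = sym e
  Adj-sym {b _} {a _} e        = sym e
  Adj-sym {b _} {b _} (inj₁ e) = inj₂ e
  Adj-sym {b _} {b _} (inj₂ e) = inj₁ e

  move-back : ∀ p m → vertex (move (move p m) (back m)) ≡ vertex p
  move-back (pos outer x y) fwd   = cong (λ x → vertex (pos outer x y)) (i+j-j≡i x 1ℤ)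
  move-back (pos outer x y) bwd   = cong (λ x → vertex (pos outer x y)) (i-j+j≡i x 1ℤ)
  move-back (pos inner x y) fwd   = cong (λ y → vertex (pos inner x y)) (i+j-j≡i y 1ℤ)
  move-back (pos inner x y) bwd   = cong (λ y → vertex (pos inner x y)) (i-j+j≡i y 1ℤ)
  move-back (pos outer x y) spoke = refl
  move-back (pos inner x y) spoke = refl

  infix 4 _∈ᵥ_
  _∈ᵥ_ : Vertex n → List Pos → Set
  v ∈ᵥ ps = Any (λ p → v ≡ vertex p) ps

  Near : Vertex n → Vertex n → Set
  Near w v = w ≡ v ⊎ Adj n k w v

  ∈ᵥ-map : ∀ {A : Set} (f : A → Pos) {x xs v} → x ∈ xs → v ≡ vertex (f x) → v ∈ᵥ map f xs
  ∈ᵥ-map f x∈xs v≡fx = map⁺ (lose x∈xs v≡fx)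

  ∈ᵥ-concatMap : ∀ {A : Set} (f : A → List Pos) {x xs v} →
                 x ∈ xs → v ∈ᵥ f x → v ∈ᵥ concatMap f xs
  ∈ᵥ-concatMap f x∈xs v∈fx = concatMap⁺ f (lose x∈xs v∈fx)

  step-onward : ∀ p m {v} → Adj n k (vertex (move p m)) v → v ≢ vertex p →
                ∃ λ m′ → m′ ∈ forward m × v ≡ vertex (move (move p m) m′)
  step-onward p m adj v≢p with adjacent-move (move p m) adj
  ... | m′ , v≡ with ≡⊎∈others (back m) m′
  ...   | inj₁ refl = contradiction (trans v≡ (move-back p m)) v≢p
  ...   | inj₂ m′∈  = m′ , m′∈ , v≡

  branch-complete : ∀ p μ {v} → InBranch n k (vertex p) (vertex (move p μ)) v → v ∈ᵥ branch p μ
  branch-complete p μ (inj₁ v≡p)        = here v≡p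
  branch-complete p μ (inj₂ (inj₁ v≡u)) = there (here v≡u)
  branch-complete p μ {v} (inj₂ (inj₂ (w , u~w , w≢p , w-to-v))) with step-onward p μ u~w w≢p
  ... | ν , ν∈ , w≡ = there (there (∈ᵥ-concatMap (fan forward u) ν∈ (last-step w-to-v)))
    where
      u = move p μ
      last-step : v ≡ w ⊎ (Adj n k w v × v ≢ vertex u) → v ∈ᵥ fan forward u ν
      last-step (inj₁ v≡w) = here (trans v≡w w≡)
      last-step (inj₂ (w~v , v≢u)) with step-onward u ν (subst (λ w → Adj n k w v) w≡ w~v) v≢u
      ... | ξ , ξ∈ , v≡ = there (∈ᵥ-map (move (move u ν)) ξ∈ v≡)

  near-complete : ∀ p {v} → Near v (vertex p) → v ∈ᵥ nbhd p
  near-complete p (inj₁ v≡p) = here v≡p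
  near-complete p (inj₂ v~p) with adjacent-move p (Adj-sym v~p)
  ... | m , v≡ = there (∈ᵥ-map (move p) (∈-moves m) v≡)

  ball-complete : ∀ p {v} → DistLe n k 2 v (vertex p) → v ∈ᵥ ball₂ p
  ball-complete p (inj₁ v≡p) = here v≡p
  ball-complete p (inj₂ (w , v~w , inj₁ w≡p)) with adjacent-move p (Adj-sym (subst (Adj n k _) w≡p v~w))
  ... | m , v≡ = there (∈ᵥ-concatMap (fan (λ _ → moves) p) (∈-moves m) (here v≡))
  ball-complete p {v} (inj₂ (w , v~w , inj₂ (_ , w~p , refl))) with adjacent-move p (Adj-sym w~p)
  ... | m , w≡ with adjacent-move (move p m) (subst (λ w → Adj n k w v) w≡ (Adj-sym v~w))
  ...   | m′ , v≡ = there (∈ᵥ-concatMap (fan (λ _ → moves) p) (∈-moves m)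
                             (there (∈ᵥ-map (move (move p m)) (∈-moves m′) v≡)))

Apartness : Set
Apartness = ℤ → ℤ → Bool

Separates : ℕ → ℕ → Apartness → Set
Separates n k apart? = ∀ x y → T (apart? x y) → ¬ (+ n ∣ x + y ℤ.* + k)

distinct? : Apartness → Pos → Pos → Bool
distinct? apart? (pos outer x y) (pos outer x′ y′) = apart? (x - x′) (y - y′)
distinct? apart? (pos inner x y) (pos inner x′ y′) = apart? (x - x′) (y - y′)
distinct? apart? _               _                 = true

disjoint? : Apartness → List Pos → List Pos → Bool
disjoint? apart? ps qs = all (λ p → all (distinct? apart? p) qs) ps

all-forward? : (Move → Move → Bool) → Bool
all-forward? p = all (λ α → all (p α) (forward α)) moves

all-others? : (Move → Move → Bool) → Bool
all-others? p = all (λ α → all (p α) (others α)) moves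

module Checks (apart? : Apartness) (s : Side) where

  deep₁ deep₂ : Move → List Pos
  deep₁ α = deep s α (other₁ (back α))
  deep₂ α = deep s α (other₂ (back α))

  apex-off-root? : Move → Move → Bool
  apex-off-root? α μ = distinct? apart? (move (neighbour s α) μ) (origin s)

  deep-off-ball? : Move → Move → Bool
  deep-off-ball? α μ = disjoint? apart? (deep s α μ) (ball₂ (origin s))

  branch-off-neighbourhood? : Move → Move → Move → Bool
  branch-off-neighbourhood? α β μ = disjoint? apart? (branch (neighbour s α) μ) (nbhd (neighbour s β))

  branches-off-neighbourhood? : Move → Move → Bool
  branches-off-neighbourhood? α β = all (branch-off-neighbourhood? α β) (forward α)

  deep-parts-disjoint? : Move → Bool
  deep-parts-disjoint? α = disjoint? apart? (deep₁ α) (deep₂ α)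

  branch-dodges? : Move → Pos → Pos → Move → Bool
  branch-dodges? γ p q μ = disjoint? apart? (p ∷ q ∷ []) (branch (neighbour s γ) μ)

  some-branch-dodges? : Move → Pos → Pos → Bool
  some-branch-dodges? γ p q = any (branch-dodges? γ p q) (forward γ)

  branches-dodge? : Move → Move → Bool
  branches-dodge? α γ = all (λ p → all (some-branch-dodges? γ p) (deep₂ α)) (deep₁ α)

  record Valid : Set where
    field
      apexes-off-root             : T (all-forward? apex-off-root?)
      deep-off-ball               : T (all-forward? deep-off-ball?)
      branches-off-neighbourhoods : T (all-others? branches-off-neighbourhood?)
      deep-parts-disjoint         : T (all deep-parts-disjoint? moves)
      branches-dodge              : T (all-others? branches-dodge?)

T-all : ∀ {A : Set} (f : A → Bool) {xs x} → T (all f xs) → x ∈ xs → T (f x)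
T-all f {xs} t = All.lookup (all⁺ f xs t)

T-any : ∀ {A : Set} (f : A → Bool) {xs} → T (any f xs) → ∃ λ x → x ∈ xs × T (f x)
T-any f {xs} t = find (any⁻ f xs t)

T-all-forward : ∀ p → T (all-forward? p) → ∀ α {μ} → μ ∈ forward α → T (p α μ)
T-all-forward p t α = T-all (p α) (T-all (λ α → all (p α) (forward α)) t (∈-moves α))

T-all-others : ∀ p → T (all-others? p) → ∀ α {β} → β ∈ others α → T (p α β)
T-all-others p t α = T-all (p α) (T-all (λ α → all (p α) (others α)) t (∈-moves α))

some-two-equal : ∀ (w x y z : Fin 3) → x ≡ y ⊎ x ≡ z ⊎ y ≡ z ⊎ w ≡ x ⊎ w ≡ y ⊎ w ≡ z
some-two-equal = toWitness {a? = all? λ w → all? λ x → all? λ y → all? λ z →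
  (x ≟ y) ⊎-dec (x ≟ z) ⊎-dec (y ≟ z) ⊎-dec (w ≟ x) ⊎-dec (w ≟ y) ⊎-dec (w ≟ z)} _

no-four-distinct : ∀ {w x y z : Fin 3} → x ≢ y → x ≢ z → y ≢ z → w ≢ x → w ≢ y → w ≢ z → ⊥
no-four-distinct {w} {x} {y} {z} x≢y x≢z y≢z w≢x w≢y w≢z with some-two-equal w x y z
... | inj₁ x≡y                             = x≢y x≡y
... | inj₂ (inj₁ x≡z)                      = x≢z x≡z
... | inj₂ (inj₂ (inj₁ y≡z))               = y≢z y≡z
... | inj₂ (inj₂ (inj₂ (inj₁ w≡x)))        = w≢x w≡x
... | inj₂ (inj₂ (inj₂ (inj₂ (inj₁ w≡y)))) = w≢y w≡y
... | inj₂ (inj₂ (inj₂ (inj₂ (inj₂ w≡z)))) = w≢z w≡z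

module Trapping {n k : ℕ} .{{_ : NonZero n}} {apart? : Apartness} (separates : Separates n k apart?)
                (j : ℕ) (s : Side) (valid : Checks.Valid apart? s) (c : Cops n) where

  open Geometry n k j
  open Checks apart? s
  open Valid valid

  o : Pos
  o = origin s

  r : Vertex n
  r = vertex o

  v : Move → Vertex n
  v α = vertex (neighbour s α)

  Covered : Vertex n → Set
  Covered w = ∃ λ i → Near (c i) w

  separated : ∀ s x y x′ y′ → T (apart? (x - x′) (y - y′)) →
              vertex (pos s x y) ≢ vertex (pos s x′ y′)
  separated s x y x′ y′ t eq
    with fromℤ-mod n {index (pos s x y)} {index (pos s x′ y′)} (vertexOn-injective s eq)
  ... | congruent n∣ = separates _ _ t (subst (+ n ∣_) (difference (+ j) x y x′ y′ (+ k)) n∣)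
    where difference : ∀ j x y x′ y′ k →
                       j + x + y ℤ.* k - (j + x′ + y′ ℤ.* k) ≡ (x - x′) + (y - y′) ℤ.* k
          difference = ℤ-Ring.solve-∀

  distinct?-sound : ∀ p q → T (distinct? apart? p q) → vertex p ≢ vertex q
  distinct?-sound (pos outer x y) (pos outer x′ y′) t eq = separated outer x y x′ y′ t eq
  distinct?-sound (pos inner x y) (pos inner x′ y′) t eq = separated inner x y x′ y′ t eq
  distinct?-sound (pos outer _ _) (pos inner _ _)   _ ()
  distinct?-sound (pos inner _ _) (pos outer _ _)   _ ()

  disjoint?-sound : ∀ ps qs {w} → T (disjoint? apart? ps qs) → w ∈ᵥ ps → w ∈ᵥ qs → ⊥
  disjoint?-sound ps qs t w∈ps w∈qs with lookupAny (all⁺ _ ps t) w∈ps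
  ... | t′ , w≡p with lookupAny (all⁺ _ qs t′) w∈qs
  ...   | t″ , w≡q = distinct?-sound _ _ t″ (trans (sym w≡p) w≡q)

  apex-≢-root : ∀ α {μ} → μ ∈ forward α → vertex (move (neighbour s α) μ) ≢ r
  apex-≢-root α μ∈ = distinct?-sound _ _ (T-all-forward apex-off-root? apexes-off-root α μ∈)

  deep-far : ∀ α {μ w} → μ ∈ forward α → w ∈ᵥ deep s α μ → ¬ DistLe n k 2 w r
  deep-far α μ∈ w∈ w~r =
    disjoint?-sound (deep s α _) (ball₂ o) (T-all-forward deep-off-ball? deep-off-ball α μ∈)
      w∈ (ball-complete o w~r)

  branch-not-near : ∀ α {β μ w} → β ∈ others α → μ ∈ forward α →
                    w ∈ᵥ branch (neighbour s α) μ → ¬ Near w (v β)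
  branch-not-near α {β} {μ} β∈ μ∈ w∈ near =
    disjoint?-sound (branch (neighbour s α) μ) (nbhd (neighbour s β))
      (T-all (branch-off-neighbourhood? α β)
        (T-all-others branches-off-neighbourhood? branches-off-neighbourhoods α β∈) μ∈)
      w∈ (near-complete (neighbour s β) near)

  deep-parts-apart : ∀ α {w} → w ∈ᵥ deep₁ α → ¬ w ∈ᵥ deep₂ α
  deep-parts-apart α =
    disjoint?-sound (deep₁ α) (deep₂ α) (T-all deep-parts-disjoint? deep-parts-disjoint (∈-moves α))

  dodging-branch : ∀ α {γ w w′} → γ ∈ others α → w ∈ᵥ deep₁ α → w′ ∈ᵥ deep₂ α →
                   ∃ λ μ → μ ∈ forward γ × ¬ w ∈ᵥ branch (neighbour s γ) μ
                                         × ¬ w′ ∈ᵥ branch (neighbour s γ) μ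
  dodging-branch α {γ} γ∈ w∈ w′∈ =
    let t , w≡p     = lookupAny (all⁺ (λ p → all (some-branch-dodges? γ p) (deep₂ α)) (deep₁ α)
                                      (T-all-others branches-dodge? branches-dodge α γ∈)) w∈
        t′ , w′≡q   = lookupAny (all⁺ (some-branch-dodges? γ (Any.lookup w∈)) (deep₂ α) t) w′∈
        μ , μ∈ , t″ = T-any (branch-dodges? γ (Any.lookup w∈) (Any.lookup w′∈)) t′
        dodges      = λ {x} → disjoint?-sound (Any.lookup w∈ ∷ Any.lookup w′∈ ∷ [])
                                              (branch (neighbour s γ) μ) {x} t″
    in μ , μ∈ , dodges (here w≡p) , dodges (there (here w′≡q))

  near-or-deep : ∀ α {μ w} → w ∈ᵥ branch (neighbour s α) μ → Near w (v α) ⊎ w ∈ᵥ deep s α μ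
  near-or-deep α (here w≡v)             = inj₁ (inj₁ w≡v)
  near-or-deep α {μ} (there (here w≡u)) =
    inj₁ (inj₂ (subst (λ w → Adj n k w (v α)) (sym w≡u) (Adj-sym (move-adjacent (neighbour s α) μ))))
  near-or-deep α (there (there w∈))     = inj₂ w∈

  close-cop : ∀ α → CloseCop n k c r (v α) →
              ∃ λ i → Near (c i) (v α) × ∃ λ μ → μ ∈ forward α × c i ∈ᵥ branch (neighbour s α) μ
  close-cop α (u , v~u , u≢r , i , i-on-branch , i~r) with step-onward o α v~u u≢r
  ... | μ , μ∈ , u≡
    with branch-complete (neighbour s α) μ (subst (λ u → InBranch n k (v α) u (c i)) u≡ i-on-branch)
  ...   | i∈ = [ (λ near → i , near , μ , μ∈ , i∈) , (λ i∈deep → ⊥-elim (deep-far α μ∈ i∈deep i~r)) ]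
                 (near-or-deep α i∈)

  branch-cop : ∀ α → BothBranches n k c r (v α) → ∀ {μ} → μ ∈ forward α →
               ∃ λ i → c i ∈ᵥ branch (neighbour s α) μ
  branch-cop α both {μ} μ∈ with both _ (move-adjacent (neighbour s α) μ) (apex-≢-root α μ∈)
  ... | i , i-on-branch = i , branch-complete (neighbour s α) μ i-on-branch

  off-branch : ∀ {z i ps} → c z ∈ᵥ ps → ¬ c i ∈ᵥ ps → z ≢ i
  off-branch z∈ i∉ refl = i∉ z∈

  module _ (H : ∀ w → Adj n k r w → CloseCop n k c r w ⊎ BothBranches n k c r w) where

    spread-thin : ∀ α {β i₀ i₁ i₂} → β ∈ others α → Near (c i₀) (v β) →
                  c i₁ ∈ᵥ deep₁ α → c i₂ ∈ᵥ deep₂ α → ⊥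
    spread-thin α {β} {i₀} {i₁} {i₂} β∈ near₀ deep₁ deep₂ with third α β∈
    ... | γ , γ∈ , β∈′ = [ via-close , via-branches ] (H (v γ) (move-adjacent o γ))
      where
        i₀≢i₁ : i₀ ≢ i₁
        i₀≢i₁ refl = branch-not-near α β∈ (here refl) (there (there deep₁)) near₀
        i₀≢i₂ : i₀ ≢ i₂
        i₀≢i₂ refl = branch-not-near α β∈ (there (here refl)) (there (there deep₂)) near₀
        i₁≢i₂ : i₁ ≢ i₂
        i₁≢i₂ refl = deep-parts-apart α deep₁ deep₂
        not-i₀ : ∀ {z μ} → μ ∈ forward γ → c z ∈ᵥ branch (neighbour s γ) μ → z ≢ i₀
        not-i₀ μ∈ z∈ refl = branch-not-near γ β∈′ μ∈ z∈ near₀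
        not-i₁ : ∀ {z} → Near (c z) (v γ) → z ≢ i₁
        not-i₁ near refl = branch-not-near α γ∈ (here refl) (there (there deep₁)) near
        not-i₂ : ∀ {z} → Near (c z) (v γ) → z ≢ i₂
        not-i₂ near refl = branch-not-near α γ∈ (there (here refl)) (there (there deep₂)) near
        fourth-cop : ∀ {z μ} → μ ∈ forward γ → c z ∈ᵥ branch (neighbour s γ) μ →
                     z ≢ i₁ → z ≢ i₂ → ⊥
        fourth-cop μ∈ z∈ = no-four-distinct i₀≢i₁ i₀≢i₂ i₁≢i₂ (not-i₀ μ∈ z∈)
        via-close : CloseCop n k c r (v γ) → ⊥
        via-close close =
          let z , near-z , μ , μ∈ , z∈ = close-cop γ close
          in fourth-cop μ∈ z∈ (not-i₁ near-z) (not-i₂ near-z)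
        via-branches : BothBranches n k c r (v γ) → ⊥
        via-branches both =
          let μ , μ∈ , i₁∉ , i₂∉ = dodging-branch α γ∈ deep₁ deep₂
              z , z∈ = branch-cop γ both μ∈
          in fourth-cop μ∈ z∈ (off-branch z∈ i₁∉) (off-branch z∈ i₂∉)

    covered-by-close : ∀ α → CloseCop n k c r (v α) → Covered (v α)
    covered-by-close α close = let i , near , _ = close-cop α close in i , near

    covered-or-spread : ∀ α {β i₀ i₁ i₂} → Near (c i₀) (v β) → α ≡ β ⊎ β ∈ others α →
                        Near (c i₁) (v α) ⊎ c i₁ ∈ᵥ deep₁ α → Near (c i₂) (v α) ⊎ c i₂ ∈ᵥ deep₂ α →
                        Covered (v α)
    covered-or-spread α _     _           (inj₁ near₁) _            = _ , near₁
    covered-or-spread α _     _           (inj₂ _)     (inj₁ near₂) = _ , near₂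
    covered-or-spread α near₀ (inj₁ refl) (inj₂ _)     (inj₂ _)     = _ , near₀
    covered-or-spread α near₀ (inj₂ β∈)   (inj₂ deep₁) (inj₂ deep₂) =
      ⊥-elim (spread-thin α β∈ near₀ deep₁ deep₂)

    covered-by-branches : (∃ λ w → Adj n k r w × CloseCop n k c r w) →
                          ∀ α → BothBranches n k c r (v α) → Covered (v α)
    covered-by-branches (w , r~w , close-w) α both =
      let β , w≡vβ       = adjacent-move o r~w
          _ , near₀ , _  = close-cop β (subst (CloseCop n k c r) w≡vβ close-w)
          _ , on-branch₁ = branch-cop α both (here refl)
          _ , on-branch₂ = branch-cop α both (there (here refl))
      in covered-or-spread α near₀ (≡⊎∈others α β)
           (near-or-deep α on-branch₁) (near-or-deep α on-branch₂)

    trapped : (∃ λ w → Adj n k r w × CloseCop n k c r w) → ∀ w → Adj n k r w → Covered w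
    trapped close-somewhere w r~w with adjacent-move o r~w
    ... | α , refl = [ covered-by-close α , covered-by-branches close-somewhere α ] (H (v α) r~w)

record Certificate (n k : ℕ) : Set where
  field
    apart?    : Apartness
    separates : Separates n k apart?
    valid     : ∀ s → Checks.Valid apart? s

Trap : (n k : ℕ) .{{_ : NonZero n}} → Cops n → Vertex n → Set
Trap n k c r =
  (∀ w → Adj n k r w → CloseCop n k c r w ⊎ BothBranches n k c r w) →
  (∃ λ w → Adj n k r w × CloseCop n k c r w) →
  ∀ w → Adj n k r w → ∃ λ i → (c i ≡ w) ⊎ Adj n k (c i) w

trap-on : ∀ {n k} .{{_ : NonZero n}} → Certificate n k → ∀ c s j → Trap n k c (vertexOn s j)
trap-on {n} {k} cert c s j = subst (Trap n k c) root (Trapping.trapped separates (toℕ j) s (valid s) c)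
  where
    open Certificate cert
    open Geometry n k (toℕ j)
    root : vertex (origin s) ≡ vertexOn s j
    root = trans (vertex-origin s) (cong (vertexOn s) (fromℤ-toℕ n j))

certified-trap : ∀ {n k} .{{_ : NonZero n}} → Certificate n k → ∀ c r → Trap n k c r
certified-trap cert c (a j) = trap-on cert c outer j
certified-trap cert c (b j) = trap-on cert c inner j

indivisible? : (d : ℕ) .{{_ : NonZero d}} → ℕ → Bool
indivisible? d m = not (m % d ≡ᵇ 0)

indivisible?-sound : ∀ d {m} .{{_ : NonZero d}} → T (indivisible? d m) → ¬ d ℕ∣.∣ m
indivisible?-sound d {m} t d∣m = subst (λ r → T (not (r ≡ᵇ 0))) (ℕ∣.n∣m⇒m%n≡0 m d d∣m) t

residue-apart : (n k : ℕ) .{{_ : NonZero n}} → Apartness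
residue-apart n k x y = indivisible? n ∣ x + y ℤ.* + k ∣

residue-separates : ∀ n k .{{_ : NonZero n}} → Separates n k (residue-apart n k)
residue-separates n k x y apart n∣ = indivisible?-sound n apart (∣⇒∣ᵤ n∣)

residue-certificate : ∀ n k .{{_ : NonZero n}} →
  Checks.Valid (residue-apart n k) outer → Checks.Valid (residue-apart n k) inner → Certificate n k
residue-certificate n k valid-outer valid-inner = record
  { apart?    = residue-apart n k
  ; separates = residue-separates n k
  ; valid     = λ { outer → valid-outer ; inner → valid-inner } }

-- Offsets of vertices within distance 4 of the origin differ by at most 8 in x.  For n = 7m and
-- k = im with m ≥ 9 and 7 ∤ i, a multiple x + y k of n therefore has x = 0, and then 7 ∣ y.
sevenfold-apart : Apartness
sevenfold-apart (+ zero) y = indivisible? 7 ∣ y ∣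
sevenfold-apart x        y = ∣ x ∣ ≤ᵇ 8

prime[7] : Prime 7
prime[7] = from-yes (prime? 7)

+m∣+[m*n] : ∀ m i → + m ∣ + (m * i)
+m∣+[m*n] m i = divides (+ i) (trans (ℤ.pos-* m i) (ℤ.*-comm (+ m) (+ i)))

offset-bound : ∀ m i x y → .{{NonZero ∣ x ∣}} → T (∣ x ∣ ≤ᵇ 8) →
               + ((9 ℕ.+ m) * 7) ∣ x + y ℤ.* + ((9 ℕ.+ m) * i) → 9 ≤ 8
offset-bound m i x y small n∣ =
  ℕ.≤-trans (ℕ.m≤m+n 9 m) (ℕ.≤-trans (ℕ∣.∣⇒≤ (∣⇒∣ᵤ M∣x)) (ℕ.≤ᵇ⇒≤ _ 8 small))
  where
    M = 9 ℕ.+ m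
    M∣x : + M ∣ x
    M∣x = ∣m+n∣n⇒∣m (∣-trans (+m∣+[m*n] M 7) n∣) (∣n⇒∣m*n y (+m∣+[m*n] M i))

sevenfold-separates : ∀ m i → ¬ 7 ℕ∣.∣ i → Separates ((9 ℕ.+ m) * 7) ((9 ℕ.+ m) * i) sevenfold-apart
sevenfold-separates m i 7∤i (+ zero) y apart n∣ = indivisible?-sound 7 apart 7∣∣y∣
  where
    M = 9 ℕ.+ m
    M7∣M[yi] : M * 7 ℕ∣.∣ M * (∣ y ∣ * i)
    M7∣M[yi] = subst (M * 7 ℕ∣.∣_)
      (trans (cong ∣_∣ (ℤ.+-identityˡ (y ℤ.* + (M * i))))
             (trans (ℤ.abs-* y (+ (M * i))) (rearrange ∣ y ∣ M i)))
      (∣⇒∣ᵤ n∣)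
      where rearrange : ∀ a M i → a * (M * i) ≡ M * (a * i)
            rearrange = ℕ-Ring.solve-∀
    7∣yi : 7 ℕ∣.∣ ∣ y ∣ * i
    7∣yi = ℕ∣.*-cancelˡ-∣ M M7∣M[yi]
    7∣∣y∣ : 7 ℕ∣.∣ ∣ y ∣
    7∣∣y∣ = [ id , (λ 7∣i → contradiction 7∣i 7∤i) ] (euclidsLemma ∣ y ∣ i prime[7] 7∣yi)
sevenfold-separates m i _ x@(+ suc _)  y apart n∣ = ℕ.1+n≰n (offset-bound m i x y apart n∣)
sevenfold-separates m i _ x@(-[1+ _ ]) y apart n∣ = ℕ.1+n≰n (offset-bound m i x y apart n∣)

sevenfold-certificate : ∀ m i → ¬ 7 ℕ∣.∣ i → Certificate ((9 ℕ.+ m) * 7) ((9 ℕ.+ m) * i)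
sevenfold-certificate m i 7∤i = record
  { apart?    = sevenfold-apart
  ; separates = sevenfold-separates m i 7∤i
  ; valid     = λ { outer → _ ; inner → _ } }

7∤-small : ∀ {i} → 1 ≤ i → i ≤ 3 → ¬ 7 ℕ∣.∣ i
7∤-small {suc i} _ i≤3 = ℕ∣.>⇒∤ (s≤s (ℕ.≤-trans i≤3 (ℕ.m≤m+n 3 3)))

one-two-or-three : ∀ {i} → 1 ≤ i → i ≤ 3 → i ≡ 1 ⊎ i ≡ 2 ⊎ i ≡ 3
one-two-or-three {1} _ _ = inj₁ refl
one-two-or-three {2} _ _ = inj₂ (inj₁ refl)
one-two-or-three {3} _ _ = inj₂ (inj₂ refl)
one-two-or-three {suc (suc (suc (suc _)))} _ (s≤s (s≤s (s≤s ())))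

multiple-of-seven : ∀ {n k i} → ¬ 7 ℕ∣.∣ i → n * i ≡ 7 * k → ∃ λ m → n ≡ m * 7 × k ≡ m * i
multiple-of-seven {n} {k} {i} 7∤i ni≡7k =
  [ quotient , (λ 7∣i → contradiction 7∣i 7∤i) ]
    (euclidsLemma n i prime[7] (ℕ∣.divides k (trans ni≡7k (ℕ.*-comm 7 k))))
  where
    quotient : 7 ℕ∣.∣ n → ∃ λ m → n ≡ m * 7 × k ≡ m * i
    quotient (ℕ∣.divides m n≡m7) = m , n≡m7 , ℕ.*-cancelˡ-≡ k (m * i) 7 (begin
      7 * k       ≡⟨ ni≡7k ⟨
      n * i       ≡⟨ cong (_* i) n≡m7 ⟩
      m * 7 * i   ≡⟨ rearrange m i ⟩
      7 * (m * i) ∎)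
      where open ≡-Reasoning
            rearrange : ∀ m i → m * 7 * i ≡ 7 * (m * i)
            rearrange = ℕ-Ring.solve-∀

-- The uniform certificate needs m ≥ 9, so n = 42, 49 and 56 are checked one by one.
large-certificate : ∀ m i → 6 ≤ m → 1 ≤ i → i ≤ 3 → Certificate (m * 7) (m * i)
large-certificate m i 6≤m 1≤i i≤3 with ℕ.m≤n⇒∃[o]m+o≡n 6≤m | one-two-or-three 1≤i i≤3
... | 0 , refl | inj₁ refl              = residue-certificate 42  6 _ _
... | 0 , refl | inj₂ (inj₁ refl)       = residue-certificate 42 12 _ _
... | 0 , refl | inj₂ (inj₂ refl)       = residue-certificate 42 18 _ _
... | 1 , refl | inj₁ refl              = residue-certificate 49  7 _ _
... | 1 , refl | inj₂ (inj₁ refl)       = residue-certificate 49 14 _ _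
... | 1 , refl | inj₂ (inj₂ refl)       = residue-certificate 49 21 _ _
... | 2 , refl | inj₁ refl              = residue-certificate 56  8 _ _
... | 2 , refl | inj₂ (inj₁ refl)       = residue-certificate 56 16 _ _
... | 2 , refl | inj₂ (inj₂ refl)       = residue-certificate 56 24 _ _
... | suc (suc (suc m′)) , refl | _     = sevenfold-certificate m′ i (7∤-small 1≤i i≤3)

certificate : ∀ {n k} .{{_ : NonZero n}} → (Σ ℕ λ i → 1 ≤ i × i ≤ 3 × n * i ≡ 7 * k) →
  42 ≤ n ⊎ ((n ≡ 28 × k ≡ 8) ⊎ (n ≡ 35 × k ≡ 10) ⊎ (n ≡ 35 × k ≡ 15)) → Certificate n k
certificate _ (inj₂ (inj₁ (refl , refl)))        = residue-certificate 28  8 _ _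
certificate _ (inj₂ (inj₂ (inj₁ (refl , refl)))) = residue-certificate 35 10 _ _
certificate _ (inj₂ (inj₂ (inj₂ (refl , refl)))) = residue-certificate 35 15 _ _
certificate {n} {k} (i , 1≤i , i≤3 , ni≡7k) (inj₁ 42≤n)
  with multiple-of-seven {n} {k} {i} (7∤-small 1≤i i≤3) ni≡7k
... | m , refl , refl = large-certificate m i (ℕ.*-cancelʳ-≤ 6 m 7 42≤n) 1≤i i≤3

lemma2p2 : (n k : ℕ) → .{{_ : NonZero n}} →
    1 ≤ k → 5 ≤ n → k * 2 < n →
    (Σ ℕ λ i → 1 ≤ i × i ≤ 3 × n * i ≡ 7 * k) →
    (42 ≤ n ⊎ ((n ≡ 28 × k ≡ 8) ⊎ (n ≡ 35 × k ≡ 10) ⊎ (n ≡ 35 × k ≡ 15))) →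
    (c : Cops n) (r : Vertex n) →
    (∀ v → Adj n k r v → CloseCop n k c r v ⊎ BothBranches n k c r v) →
    (∃ λ v → Adj n k r v × CloseCop n k c r v) →
    (t : Turn) → Trapped n k c r t
lemma2p2 n k _ _ _ ratio admissible c r close-or-both close _ =
  inj₁ (certified-trap (certificate ratio admissible) c r close-or-both close)
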